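{- Let $m\ge2$ be an integer. Define $sf(n,m)$ for integers $n$ by $sf(n,m)=0$ for $n<0$, $sf(0,m)=1$, and for $n>0$: $sf(n,m)=sf(n/m,m)$ if $n\equiv0\pmod m$, and $sf(n,m)=sf(n-r,m)+sf(n-m,m)$ if $n\equiv r\pmod m$ with $0<r<m$. Let $1\le r\le m-1$ and let $k$ be an integer with $k\equiv m+r\pmod{2m}$ and $k\le m^2+r$. If $i\ge0$ and $n=m^ik$ satisfies $n\ge0$, then $sf(n,m)$ is even.
   Context: $sf(n,m)$ is the number of semi-$m$-Fibonacci partitions of $n$, characterized by the stated recurrence. -}

module Defs where

open import Data.Nat using (ℕ; zero; suc; _∸_; _<ᵇ_; _%_; _/_)
open import Data.Nat.Base using (NonZero)
open import Data.Integer using (ℤ; +_; -[1+_])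
open import Data.Bool using (if_then_else_)
import Data.Nat as ℕ

-- Arguments are natural numbers n ≥ 0; the paper's
-- value sf(n,m) = 0 for n < 0 is realised by the `if n <ᵇ m` test for the term
-- sf(n - m, m).  Recursive calls are on strictly smaller arguments, so fuel n + 1
-- always suffices.
sfFuel : ℕ → (m : ℕ) → .{{NonZero m}} → ℕ → ℕ
sfFuel zero    m n = 0
sfFuel (suc f) m zero = 1
sfFuel (suc f) m n@(suc _) with n % m
... | zero  = sfFuel f m (n / m)
... | r@(suc _) =
  sfFuel f m (n ∸ r) ℕ.+ (if n <ᵇ m then 0 else sfFuel f m (n ∸ m))

sfℕ : ℕ → (m : ℕ) → .{{NonZero m}} → ℕ
sfℕ n m = sfFuel (suc n) m n

sf : ℤ → (m : ℕ) → .{{NonZero m}} → ℕ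
sf (+ n)     m = sfℕ n m
sf -[1+ _ ]  m = 0

-- Subtracting the residue r and subtracting m from r + q m gives sf(r + q m) = sf(q m) + sf(r + (q-1) m),
-- and sf(q m) = sf(q) = 1 for 1 ≤ q ≤ m, so sf(r + q m) = q + 1 for 0 < r < m and q ≤ m.
-- The hypotheses on k say exactly that k = r + q m with q odd and q ≤ m, so sf(k) is even;
-- finally sf(m^i k) = sf(k) because the recurrence divides out factors of m.
module Submission where

open import Defs
import Data.Nat

module SemiFibonacci (m' : Data.Nat.ℕ) where
  open import Data.Nat
  open import Data.Nat.Properties
  open import Data.Nat.DivMod
  open import Data.Nat.Divisibility using (_∣_; divides)
  open import Data.Nat.Tactic.RingSolver using (solve-∀)
  open import Data.Bool using (true; false; if_then_else_)
  open import Data.Product using (∃-syntax; _×_; _,_)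
  open import Data.Sum using (inj₁; inj₂)
  open import Relation.Nullary.Reflects using (ofʸ; ofⁿ)
  open import Relation.Nullary.Negation using (contradiction)
  open import Relation.Binary.PropositionalEquality
  open ≡-Reasoning

  m : ℕ
  m = suc (suc m')

  1<m : 1 < m
  1<m = s≤s (s≤s z≤n)

  sfFuel-stable : ∀ {f g n} → n < f → n < g → sfFuel f m n ≡ sfFuel g m n
  sfFuel-stable {suc f} {suc g} {zero} _ _ = refl
  sfFuel-stable {suc f} {suc g} {suc n} (s≤s n<f) (s≤s n<g) with suc n % m
  ... | zero = sfFuel-stable (<-≤-trans n/m<n n<f) (<-≤-trans n/m<n n<g)
    where
      n/m<n : suc n / m < suc n
      n/m<n = m/n<m (suc n) m 1<m
  ... | suc r = cong₂ (λ x y → x + (if suc n <ᵇ m then 0 else y))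
    (sfFuel-stable (≤-trans (s≤s (m∸n≤m n r)) n<f) (≤-trans (s≤s (m∸n≤m n r)) n<g))
    (sfFuel-stable (≤-trans (s≤s (m∸n≤m n (suc m'))) n<f) (≤-trans (s≤s (m∸n≤m n (suc m'))) n<g))

  sfFuel-sufficient : ∀ {f n} → n < f → sfFuel f m n ≡ sfℕ n m
  sfFuel-sufficient n<f = sfFuel-stable n<f ≤-refl

  sfℕ-divisible : ∀ n → suc n % m ≡ 0 → sfℕ (suc n) m ≡ sfℕ (suc n / m) m
  sfℕ-divisible n eq with suc n % m | eq
  ... | .0 | refl = sfFuel-sufficient (m/n<m (suc n) m 1<m)

  sfℕ-residue : ∀ n r → suc n % m ≡ suc r → m ≤ suc n →
    sfℕ (suc n) m ≡ sfℕ (suc n ∸ suc r) m + sfℕ (suc n ∸ m) m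
  sfℕ-residue n r eq m≤n with suc n % m | eq
  ... | .(suc r) | refl with suc n <ᵇ m | <ᵇ-reflects-< (suc n) m
  ...   | true  | ofʸ n<m = contradiction n<m (≤⇒≯ m≤n)
  ...   | false | _ = cong₂ _+_ (sfFuel-sufficient (s≤s (m∸n≤m n r)))
                                (sfFuel-sufficient (s≤s (m∸n≤m n (suc m'))))

  sfℕ-below : ∀ t → suc t < m → sfℕ (suc t) m ≡ 1
  sfℕ-below t t<m with suc t % m | m<n⇒m%n≡m t<m
  ... | .(suc t) | refl with suc t <ᵇ m | <ᵇ-reflects-< (suc t) m
  ...   | true  | _ rewrite n∸n≡0 t = refl
  ...   | false | ofⁿ t≮m = contradiction t<m t≮m

  sfℕ-*m : ∀ x .{{_ : NonZero x}} → sfℕ (x * m) m ≡ sfℕ x m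
  sfℕ-*m (suc q) = begin
    sfℕ (suc q * m) m       ≡⟨ sfℕ-divisible (suc m' + q * m) (m*n%n≡0 (suc q) m) ⟩
    sfℕ (suc q * m / m) m   ≡⟨ cong (λ x → sfℕ x m) (m*n/n≡m (suc q) m) ⟩
    sfℕ (suc q) m           ∎

  sfℕ-m^i* : ∀ i n .{{_ : NonZero n}} → sfℕ (m ^ i * n) m ≡ sfℕ n m
  sfℕ-m^i* zero n = cong (λ x → sfℕ x m) (+-identityʳ n)
  sfℕ-m^i* (suc i) n = begin
    sfℕ (m * m ^ i * n) m  ≡⟨ cong (λ x → sfℕ x m) (trans (*-assoc m (m ^ i) n) (*-comm m (m ^ i * n))) ⟩
    sfℕ (m ^ i * n * m) m  ≡⟨ sfℕ-*m (m ^ i * n) {{m*n≢0 (m ^ i) n {{m^n≢0 m i}}}} ⟩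
    sfℕ (m ^ i * n) m      ≡⟨ sfℕ-m^i* i n ⟩
    sfℕ n m                ∎

  sfℕ-q*m : ∀ q → q ≤ m → sfℕ (q * m) m ≡ 1
  sfℕ-q*m zero _ = refl
  sfℕ-q*m (suc q) 1+q≤m with m≤n⇒m<n∨m≡n 1+q≤m
  ... | inj₁ 1+q<m = trans (sfℕ-*m (suc q)) (sfℕ-below q 1+q<m)
  ... | inj₂ refl = begin
    sfℕ (m * m) m      ≡⟨ sfℕ-*m m ⟩
    sfℕ m m            ≡⟨ cong (λ x → sfℕ x m) (*-identityˡ m) ⟨
    sfℕ (1 * m) m      ≡⟨ sfℕ-*m 1 ⟩
    sfℕ 1 m            ≡⟨ sfℕ-below 0 1<m ⟩
    1                  ∎

  sfℕ-r+q*m : ∀ r q → suc r < m → q ≤ m → sfℕ (suc r + q * m) m ≡ suc q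
  sfℕ-r+q*m r zero r<m _ = trans (cong (λ x → sfℕ x m) (+-identityʳ (suc r))) (sfℕ-below r r<m)
  sfℕ-r+q*m r (suc q) r<m 1+q≤m = begin
    sfℕ (suc r + suc q * m) m
      ≡⟨ sfℕ-residue (r + suc q * m) r residue m≤n ⟩
    sfℕ (suc r + suc q * m ∸ suc r) m + sfℕ (suc r + (m + q * m) ∸ m) m
      ≡⟨ cong₂ (λ x y → sfℕ x m + sfℕ y m) (m+n∸m≡n (suc r) (suc q * m)) drop-m ⟩
    sfℕ (suc q * m) m + sfℕ (suc r + q * m) m
      ≡⟨ cong₂ _+_ (sfℕ-q*m (suc q) 1+q≤m) (sfℕ-r+q*m r q r<m (≤-trans (n≤1+n q) 1+q≤m)) ⟩
    suc (suc q) ∎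
    where
      residue : (suc r + suc q * m) % m ≡ suc r
      residue = trans ([m+kn]%n≡m%n (suc r) (suc q) m) (m<n⇒m%n≡m r<m)
      m≤n : m ≤ suc r + suc q * m
      m≤n = ≤-trans (m≤m+n m (q * m)) (m≤n+m (suc q * m) (suc r))
      drop-m : suc r + (m + q * m) ∸ m ≡ suc r + q * m
      drop-m = trans (+-∸-assoc (suc r) (m≤m+n m (q * m))) (cong (suc r +_) (m+n∸m≡n m (q * m)))

  odd-multiple-identity : ∀ n r j → n + r + j * (2 * n) ≡ r + (1 + j * 2) * n
  odd-multiple-identity = solve-∀

  odd-multiple-form : ∀ r k → m + suc r ≤ k → 2 * m ∣ k ∸ (m + suc r) → k ≤ m * m + suc r →
    ∃[ j ] k ≡ suc r + suc (j * 2) * m × suc (j * 2) ≤ m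
  odd-multiple-form r k S≤k (divides j k∸S≡) k≤ = j , k≡ , *-cancelʳ-≤ (suc (j * 2)) m m bound
    where
      k≡ : k ≡ suc r + suc (j * 2) * m
      k≡ = begin
        k                                  ≡⟨ m+[n∸m]≡n S≤k ⟨
        m + suc r + (k ∸ (m + suc r))      ≡⟨ cong (m + suc r +_) k∸S≡ ⟩
        m + suc r + j * (2 * m)            ≡⟨ odd-multiple-identity m (suc r) j ⟩
        suc r + suc (j * 2) * m            ∎
      bound : suc (j * 2) * m ≤ m * m
      bound = +-cancelʳ-≤ (suc r) _ _ (subst (_≤ m * m + suc r) (trans k≡ (+-comm (suc r) _)) k≤)

  sfℕ-even : ∀ r k → suc r < m → m + suc r ≤ k → 2 * m ∣ k ∸ (m + suc r) → k ≤ m * m + suc r →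
    2 ∣ sfℕ k m
  sfℕ-even r k r<m S≤k 2m∣ k≤ with odd-multiple-form r k S≤k 2m∣ k≤
  ... | j , refl , q≤m = divides (suc j) (sfℕ-r+q*m r (suc (j * 2)) r<m q≤m)

open import Data.Nat using (ℕ; suc; _≤_; _≥_; _∸_)
open import Data.Integer using (ℤ; +_; _*_; _^_; _+_) renaming (_≤_ to _≤ℤ_)
open import Data.Integer.Divisibility using (_∣_)
open import Data.Nat.Divisibility using () renaming (_∣_ to _∣ℕ_)
import Data.Integer as ℤ
import Data.Nat as ℕ

open import Data.Nat using (zero; s≤s; z≤n)
open import Data.Integer using (-[1+_]; _⊖_)
import Data.Integer.Properties as ℤₚ
import Data.Nat.Properties as ℕₚ
open import Data.Nat.Divisibility using (∣⇒≤)
open import Relation.Nullary using (¬_; yes; no)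
open import Relation.Nullary.Negation using (contradiction)
open import Relation.Binary.PropositionalEquality using (_≡_; refl; sym; trans; cong; subst)

pos-^ : ∀ a i → (+ a) ^ i ≡ + (a ℕ.^ i)
pos-^ a zero = refl
pos-^ a (suc i) = trans (cong (+ a *_) (pos-^ a i)) (sym (ℤₚ.pos-* a (a ℕ.^ i)))

pos-*-neg-≱0 : ∀ a k .{{_ : ℕ.NonZero a}} → ¬ (+ 0 ≤ℤ + a * -[1+ k ])
pos-*-neg-≱0 (suc a) k ()

∣⊖∣-multiple⇒≥ : ∀ d s k .{{_ : ℕ.NonZero d}} → s ℕ.< d → d ∣ℕ ℤ.∣ k ⊖ s ∣ → s ≤ k
∣⊖∣-multiple⇒≥ d s k s<d d∣ with s ℕ.≤? k
... | yes s≤k = s≤k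
... | no s≰k = contradiction (ℕₚ.≤-<-trans d≤s∸k (ℕₚ.≤-<-trans (ℕₚ.m∸n≤m s k) s<d)) (ℕₚ.<-irrefl refl)
  where
    k<s : k ℕ.< s
    k<s = ℕₚ.≰⇒> s≰k
    d≤s∸k : d ≤ s ∸ k
    d≤s∸k = ∣⇒≤ {{ℕ.>-nonZero (ℕₚ.m<n⇒0<n∸m k<s)}} (subst (d ∣ℕ_) (ℤₚ.∣⊖∣-< k<s) d∣)

theorem7 : (m : ℕ) → .{{_ : ℕ.NonZero m}} → m ≥ 2 →
    (r : ℕ) → 1 ≤ r → r ≤ m ∸ 1 →
    (k : ℤ) → (+ (2 ℕ.* m)) ∣ (k ℤ.- (+ m + + r)) → k ≤ℤ (+ (m ℕ.* m ℕ.+ r)) →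
    (i : ℕ) → ℤ.+ 0 ≤ℤ ((+ m) ^ i) * k →
    2 ∣ℕ sf (((+ m) ^ i) * k) m
theorem7 m@(suc (suc m')) _ (suc r) _ r≤m-1 -[1+ k ] _ _ i 0≤m^ik =
  contradiction (subst (λ x → + 0 ≤ℤ x * -[1+ k ]) (pos-^ m i) 0≤m^ik)
                (pos-*-neg-≱0 (m ℕ.^ i) k {{ℕₚ.m^n≢0 m i}})
theorem7 m@(suc (suc m')) _ (suc r) _ r≤m-1 (+ k) 2m∣ k≤ i _ =
  subst (2 ∣ℕ_) (sym sf≡) (sfℕ-even r k r<m S≤k (subst (2 ℕ.* m ∣ℕ_) (cong ℤ.∣_∣ (ℤₚ.⊖-≥ S≤k)) 2m∣) (ℤₚ.drop‿+≤+ k≤))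
  where
    open SemiFibonacci m' hiding (m)
    r<m : suc r ℕ.< m
    r<m = s≤s r≤m-1
    S≤k : m ℕ.+ suc r ≤ k
    S≤k = ∣⊖∣-multiple⇒≥ (2 ℕ.* m) (m ℕ.+ suc r) k (ℕₚ.+-monoʳ-< m (ℕₚ.≤-trans r<m (ℕₚ.m≤m+n m 0))) 2m∣
    instance
      k≢0 : ℕ.NonZero k
      k≢0 = ℕ.>-nonZero (ℕₚ.≤-trans (s≤s z≤n) S≤k)
    sf≡ : sf ((+ m) ^ i * + k) m ≡ sfℕ k m
    sf≡ = trans (cong (λ x → sf (x * + k) m) (pos-^ m i))
                (trans (cong (λ x → sf x m) (sym (ℤₚ.pos-* (m ℕ.^ i) k))) (sfℕ-m^i* i k))
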